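{- Let $\gamma,\gamma'$ be positive integers. If there exists an operad morphism $\varphi:\mathbf{CAs}^{(\gamma')}\to\mathbf{CAs}^{(\gamma)}$, then $\varphi$ is surjective and $\varphi([\mathfrak{t}]_{\equiv_{\gamma'}})=[\mathfrak{t}]_{\equiv_\gamma}$ for every binary tree $\mathfrak{t}$.
   Context: A binary tree is either the leaf or an ordered pair of binary trees. $\mathbf{Mag}$ is the nonsymmetric set-theoretic operad of binary trees ($\mathbf{Mag}(n)$ = trees with $n$ leaves), with $\mathfrak{t}\circ_i\mathfrak{s}$ grafting the root of $\mathfrak{s}$ onto the $i$-th leaf of $\mathfrak{t}$ and unit the leaf. Combs: $\mathrm{LComb}_1=\mathrm{RComb}_1=(\text{leaf},\text{leaf})$, $\mathrm{LComb}_d=(\mathrm{LComb}_{d-1},\text{leaf})$, $\mathrm{RComb}_d=(\text{leaf},\mathrm{RComb}_{d-1})$. For $\gamma\ge1$, $\equiv_\gamma$ is the smallest operad congruence on $\mathbf{Mag}$ with $\mathrm{LComb}_\gamma\equiv_\gamma\mathrm{RComb}_\gamma$, $[\mathfrak{t}]_{\equiv_\gamma}$ is the class of $\mathfrak{t}$, and $\mathbf{CAs}^{(\gamma)}:=\mathbf{Mag}/_{\equiv_\gamma}$. An operad morphism is an arity-preserving map sending unit to unit and commuting with partial compositions. -}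

module Defs where

open import Data.Nat using (ℕ; zero; suc; _+_; _∸_; _<_; _<ᵇ_)
open import Data.Bool using (if_then_else_)
open import Data.Product using (Σ; _×_; _,_)
open import Relation.Binary.PropositionalEquality using (_≡_)

data Tree : Set where
  leaf : Tree
  node : Tree → Tree → Tree

leaves : Tree → ℕ
leaves leaf = 1
leaves (node l r) = leaves l + leaves r

-- Partial composition t ∘_i s of Mag: graft the root of s onto the
-- i-th leaf of t (leaves numbered 0,1,..., leaves t - 1 from left to right).
-- Only meaningful for i < leaves t (otherwise t is returned unchanged);
-- everything below only uses it for i < leaves t.
graft : Tree → ℕ → Tree → Tree
graft leaf zero s = s
graft leaf (suc i) s = leaf
graft (node l r) i s =
  if i <ᵇ leaves l then node (graft l i s) r
  else node l (graft r (i ∸ leaves l) s)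

-- Combs: LComb (suc d) = LComb_{d+1} in the paper; LComb 1 = RComb 1 = (leaf, leaf).
LComb : ℕ → Tree
LComb zero = leaf
LComb (suc d) = node (LComb d) leaf

RComb : ℕ → Tree
RComb zero = leaf
RComb (suc d) = node leaf (RComb d)

data _≈[_]_ : Tree → ℕ → Tree → Set where
  gen   : ∀ {γ} → LComb γ ≈[ γ ] RComb γ
  refl≈ : ∀ {γ t} → t ≈[ γ ] t
  sym≈  : ∀ {γ t u} → t ≈[ γ ] u → u ≈[ γ ] t
  trans≈ : ∀ {γ t u v} → t ≈[ γ ] u → u ≈[ γ ] v → t ≈[ γ ] v
  compˡ : ∀ {γ t t' s} i → i < leaves t →
          t ≈[ γ ] t' → graft t i s ≈[ γ ] graft t' i s
  compʳ : ∀ {γ t s s'} i → i < leaves t →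
          s ≈[ γ ] s' → graft t i s ≈[ γ ] graft t i s'

-- An operad morphism CAs^(γ') → CAs^(γ), presented on representatives:
-- a map on trees that respects ≡_γ' (so it is well defined on classes),
-- preserves arity, sends the unit to the unit and commutes with partial
-- compositions, all up to ≡_γ.
record OperadMorphism (γ' γ : ℕ) : Set where
  field
    map       : Tree → Tree
    well-def  : ∀ {t u} → t ≈[ γ' ] u → map t ≈[ γ ] map u
    arity     : ∀ t → leaves (map t) ≡ leaves t
    unit      : map leaf ≈[ γ ] leaf
    comp      : ∀ t i s → i < leaves t →
                map (graft t i s) ≈[ γ ] graft (map t) i (map s)
open OperadMorphism public

Surjective : ∀ {γ' γ} → OperadMorphism γ' γ → Set
Surjective {γ'} {γ} φ =
  ∀ t → Σ Tree (λ u → leaves u ≡ leaves t × map φ u ≈[ γ ] t)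

-- The only binary tree with two leaves is the cherry (leaf, leaf), so arity
-- preservation forces φ to fix it on the nose.  Every tree is obtained from
-- the cherry by partial compositions, node l r = (cherry ∘₁ r) ∘₀ l, and φ
-- commutes with those, so by induction φ fixes every class; surjectivity
-- follows with each class as its own preimage.
module Submission where

open import Defs
open import Data.Nat using (ℕ; _≤_; _<_; s≤s; z≤n)
open import Data.Nat.Properties using (+-mono-≤; suc-injective)
open import Data.Product using (_×_; _,_)
open import Relation.Binary.PropositionalEquality using (_≡_; refl; cong; subst)

cherry : Tree
cherry = node leaf leaf

0<leaves : ∀ t → 0 < leaves t
0<leaves leaf = s≤s z≤n
0<leaves (node l r) = +-mono-≤ (0<leaves l) z≤n

2≤leaves-node : ∀ l r → 2 ≤ leaves (node l r)
2≤leaves-node l r = +-mono-≤ (0<leaves l) (0<leaves r)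

leaves≡1⇒leaf : ∀ t → leaves t ≡ 1 → t ≡ leaf
leaves≡1⇒leaf leaf _ = refl
leaves≡1⇒leaf (node l r) e with subst (2 ≤_) e (2≤leaves-node l r)
... | s≤s ()

leaves≡2⇒cherry : ∀ t → leaves t ≡ 2 → t ≡ cherry
leaves≡2⇒cherry (node leaf r) e = cong (node leaf) (leaves≡1⇒leaf r (suc-injective e))
leaves≡2⇒cherry (node (node a b) r) e
  with subst (3 ≤_) e (+-mono-≤ (2≤leaves-node a b) (0<leaves r))
... | s≤s (s≤s ())

module _ {γ' γ : ℕ} (φ : OperadMorphism γ' γ) where

  map-cherry : map φ cherry ≡ cherry
  map-cherry = leaves≡2⇒cherry _ (arity φ cherry)

  map-fixes : ∀ t → map φ t ≈[ γ ] t
  map-fixes leaf = unit φ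
  map-fixes (node l r) =
    trans≈ (comp φ (node leaf r) 0 l (0<leaves (node leaf r)))
   (trans≈ (compˡ 0 (0<leaves (map φ (node leaf r))) map-node-leaf)
           (compʳ {t = node leaf r} 0 (0<leaves (node leaf r)) (map-fixes l)))
    where
    map-node-leaf : map φ (node leaf r) ≈[ γ ] node leaf r
    map-node-leaf =
      trans≈ (subst (λ c → map φ (node leaf r) ≈[ γ ] graft c 1 (map φ r)) map-cherry
                    (comp φ cherry 1 r (s≤s (s≤s z≤n))))
             (compʳ {t = cherry} 1 (s≤s (s≤s z≤n)) (map-fixes r))

lemma3p2p2 : (γ γ' : ℕ) → 1 ≤ γ → 1 ≤ γ' → (φ : OperadMorphism γ' γ) →
    Surjective φ × (∀ t → map φ t ≈[ γ ] t)
lemma3p2p2 γ γ' _ _ φ = (λ t → t , refl , map-fixes φ t) , map-fixes φ
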